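{- Let $G$ be a graph and let $(A,B,X)$ be a partition of $V(G)$ into three sets. Let $C_A$ be the $A$-K\"onig cover of the bipartite graph $G[A,B\cup X]$, and let $C$ be any minimum vertex cover of the bipartite graph $G[A\cup X,B]$. Then $A\cap C\subseteq A\cap C_A$ and $B\cap C\supseteq B\cap C_A$.
   Context: For disjoint vertex sets $P,Q$ of a graph $G$, $G[P,Q]$ denotes the bipartite graph with vertex set $P\cup Q$, parts $P$ and $Q$, and edge set consisting of the edges of $G$ with one end in $P$ and the other in $Q$. For a bipartite graph $H$ with parts $P$ and $Q$ and a maximum matching $M$ of $H$, the $P$-K\"onig cover of $H$ is the vertex set $C$ obtained as follows: for each edge $pq\in M$ with $p\in P$, $q\in Q$, if $pq$ lies on an $M$-alternating path (a path whose edges alternate between non-matching and matching edges) starting in a vertex of $P$ not incident with any edge of $M$, put $q$ into $C$; otherwise put $p$ into $C$. This set is a minimum vertex cover of $H$, and it does not depend on the choice of maximum matching $M$. -}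

module Defs where

open import Data.Nat using (ℕ; _≤_)
open import Data.Bool using (Bool; true; false; not)
open import Data.Fin using (Fin)
open import Data.Fin.Subset using (Subset; _∈_; _∉_; _∪_; _∩_; _⊆_; ∣_∣; ⊥; ⊤)
open import Data.List using (List; []; _∷_; _++_; map; length)
open import Data.List.Relation.Unary.Unique.Propositional using (Unique)
import Data.List.Membership.Propositional as LM
open import Data.Product using (_×_; _,_; proj₁; proj₂; Σ; ∃; ∃-syntax)
open import Data.Sum using (_⊎_)
open import Relation.Binary.PropositionalEquality using (_≡_)
open import Relation.Nullary using (¬_)
open import Data.Empty renaming (⊥ to ⊥′)

record Graph (n : ℕ) : Set where
  field
    adj   : Fin n → Fin n → Bool
    sym   : ∀ u v → adj u v ≡ adj v u
    irref : ∀ v → adj v v ≡ false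
open Graph public

module _ {n : ℕ} (G : Graph n) (P Q : Subset n) where

  BipEdge : Fin n → Fin n → Set
  BipEdge p q = p ∈ P × q ∈ Q × adj G p q ≡ true

  HEdge : Fin n → Fin n → Set
  HEdge u v = BipEdge u v ⊎ BipEdge v u

  IsMatching : List (Fin n × Fin n) → Set
  IsMatching M = (∀ {e} → e LM.∈ M → BipEdge (proj₁ e) (proj₂ e))
               × Unique (map proj₁ M ++ map proj₂ M)

  IsMaximumMatching : List (Fin n × Fin n) → Set
  IsMaximumMatching M = IsMatching M
                      × (∀ M′ → IsMatching M′ → length M′ ≤ length M)

  IsVertexCover : Subset n → Set
  IsVertexCover C = C ⊆ (P ∪ Q) × (∀ p q → BipEdge p q → p ∈ C ⊎ q ∈ C)

  IsMinVertexCover : Subset n → Set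
  IsMinVertexCover C = IsVertexCover C
                     × (∀ D → IsVertexCover D → ∣ C ∣ ≤ ∣ D ∣)

  module _ (M : List (Fin n × Fin n)) where

    InM : Fin n → Fin n → Set
    InM u v = (u , v) LM.∈ M ⊎ (v , u) LM.∈ M

    Unmatched : Fin n → Set
    Unmatched v = ¬ (v LM.∈ (map proj₁ M ++ map proj₂ M))

    MatchCond : Bool → Fin n → Fin n → Set
    MatchCond true  u v = InM u v
    MatchCond false u v = ¬ InM u v

    -- Alt b vs : vs is a walk in G[P,Q] whose edges alternate between
    -- matching and non-matching edges, the first edge being a matching
    -- edge iff b ≡ true.
    data Alt : Bool → List (Fin n) → Set where
      single : ∀ {b} v → Alt b (v ∷ [])
      step   : ∀ {b} u v vs → HEdge u v → MatchCond b u v →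
               Alt (not b) (v ∷ vs) → Alt b (u ∷ v ∷ vs)

    AltPathFromFree : List (Fin n) → Set
    AltPathFromFree [] = ⊥′
    AltPathFromFree (v ∷ vs) =
      v ∈ P × Unmatched v × Unique (v ∷ vs) × Alt false (v ∷ vs)

    OnPath : Fin n → Fin n → List (Fin n) → Set
    OnPath x y vs = ∃[ l ] ∃[ r ] (vs ≡ l ++ x ∷ y ∷ r ⊎ vs ≡ l ++ y ∷ x ∷ r)

    OnFreeAltPath : Fin n → Fin n → Set
    OnFreeAltPath p q = ∃[ vs ] (AltPathFromFree vs × OnPath p q vs)

    InKonigCover : Fin n → Set
    InKonigCover v = ∃[ p ] ∃[ q ] ((p , q) LM.∈ M ×
      ((OnFreeAltPath p q × v ≡ q) ⊎ (¬ OnFreeAltPath p q × v ≡ p)))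

IsPartition3 : ∀ {n} → Subset n → Subset n → Subset n → Set
IsPartition3 A B X = (A ∩ B ≡ ⊥) × (A ∩ X ≡ ⊥) × (B ∩ X ≡ ⊥) × ((A ∪ B) ∪ X ≡ ⊤)

module Submission where

-- Write Q = B ∪ X.  The proof studies the set R ⊆ A of A-vertices reachable from
-- M-unmatched A-vertices by M-alternating walks in G[A,Q] (entering each new
-- A-vertex through its matching edge).  Three facts about R give the theorem:
--   (1) Berge: every Q-neighbour of R is matched, since otherwise the walk to it
--       could be turned into an augmenting path, contradicting maximality of M;
--   (2) exchange: R ∩ C = ∅.  If a ∈ R ∩ C entered R at the earliest possible
--       stage, then (C ∖ R) ∪ (B-neighbours of R outside C) is a vertex cover of
--       G[A∪X,B], and matching partners inject its new vertices into R ∩ C ∖ {a},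
--       so it is smaller than C;
--   (3) every A-vertex on an alternating path from an unmatched A-vertex is in R.
-- An A-vertex of C is then matched (unmatched ones lie in R) by an edge lying on
-- no such path (its A-end would be in R), so it belongs to the A-König cover C_A;
-- a B-vertex of C_A is the Q-end of a matching edge pq on such a path, so p ∈ R,
-- p ∉ C, and q ∈ C because C covers pq.  R is built
-- as the limit of an increasing chain of subsets so that it is decidable, which
-- the exchange argument needs in order to form the smaller cover.

open import Defs hiding (sym)
open import Data.Nat using (ℕ; zero; suc; _≤_; _<_; z≤n; s≤s)
open import Data.Nat.Properties using (≤-trans; ≤-<-trans; <-irrefl)
open import Data.Bool using (Bool; true; false)
open import Data.Bool.Properties using () renaming (_≟_ to _≟ᵇ_)
open import Data.Fin using (Fin; zero; suc; _≟_)
open import Data.Fin.Properties using (any?; 0≢1+n; suc-injective)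
open import Data.Fin.Permutation.Components using (transpose; transpose-inverse)
open import Data.Fin.Subset using (Subset; _∈_; _∉_; _∪_; _⊆_; ∣_∣; _-_; inside; outside)
open import Data.Fin.Subset.Properties
  using ( _∈?_; ∣p∣≤n; p⊂q⇒∣p∣<∣q∣; x∈p⇒∣p-x∣<∣p∣; x∈p∧x≢y⇒x∈p-y
        ; x∈p∩q⁺; x∈p∪q⁺; x∈p∪q⁻; ∉⊥)
open import Data.Vec using (_∷_; []; tabulate)
open import Data.Vec.Base using (here; there)
open import Data.Vec.Properties using (lookup∘tabulate; []=⇒lookup; lookup⇒[]=)
open import Data.List using (List; []; _∷_; _++_; map; length)
open import Data.List.Properties using (map-++; map-∘; map-id-local; length-map)
open import Data.List.Membership.Propositional using () renaming (_∈_ to _∈ₗ_; _∉_ to _∉ₗ_)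
open import Data.List.Membership.Propositional.Properties
  using (∈-map⁺; ∈-map⁻; ∈-++⁺ˡ; ∈-++⁺ʳ; ∈-++⁻)
import Data.List.Membership.DecPropositional as DecMembership
open import Data.List.Relation.Unary.Any using (here; there)
open import Data.List.Relation.Unary.All as All using (All; []; _∷_)
open import Data.List.Relation.Unary.All.Properties using (¬Any⇒All¬; ++⁻ˡ)
open import Data.List.Relation.Unary.Unique.Propositional using (Unique)
open import Data.List.Relation.Unary.AllPairs using ([]; _∷_)
open import Data.List.Relation.Unary.Unique.Propositional.Properties using (map⁺)
import Data.List.Relation.Binary.Permutation.Setoid as Perm
import Data.List.Relation.Binary.Permutation.Setoid.Properties as PermProps
open import Data.Product using (_×_; _,_; proj₁; proj₂; ∃-syntax)
open import Data.Product.Properties using (≡-dec)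
open import Data.Sum using (_⊎_; inj₁; inj₂; [_,_])
open import Data.Empty using (⊥-elim) renaming (⊥ to ⊥₀)
open import Function using (const)
open import Relation.Binary.PropositionalEquality
  using (_≡_; _≢_; refl; sym; trans; cong; cong₂; subst; setoid; module ≡-Reasoning)
open import Relation.Nullary using (Dec; yes; no; does)
open import Relation.Nullary.Decidable using (_×-dec_; _⊎-dec_; ¬?; dec-true; dec-false; decidable-stable)

module _ {n : ℕ} {P : Fin n → Set} where

  ⟦_⟧ : ((x : Fin n) → Dec (P x)) → Subset n
  ⟦ P? ⟧ = tabulate (λ x → does (P? x))

  ∈⟦⟧⁺ : (P? : (x : Fin n) → Dec (P x)) {x : Fin n} → P x → x ∈ ⟦ P? ⟧
  ∈⟦⟧⁺ P? {x} px = lookup⇒[]= x ⟦ P? ⟧ (trans (lookup∘tabulate _ x) (dec-true (P? x) px))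

  ∈⟦⟧⁻ : (P? : (x : Fin n) → Dec (P x)) {x : Fin n} → x ∈ ⟦ P? ⟧ → P x
  ∈⟦⟧⁻ P? {x} x∈ with P? x | trans (sym (lookup∘tabulate (λ y → does (P? y)) x)) ([]=⇒lookup x∈)
  ... | yes px | _  = px
  ... | no _   | ()

injection-≤ : ∀ {m n} (S : Subset m) (T : Subset n) (f : ∀ x → x ∈ S → Fin n) →
  (∀ {x} (x∈ : x ∈ S) → f x x∈ ∈ T) →
  (∀ {x y} (x∈ : x ∈ S) (y∈ : y ∈ S) → f x x∈ ≡ f y y∈ → x ≡ y) →
  ∣ S ∣ ≤ ∣ T ∣
injection-≤ [] T f into inj = z≤n
injection-≤ (outside ∷ S) T f into inj =
  injection-≤ S T (λ x x∈ → f (suc x) (there x∈)) (λ x∈ → into (there x∈))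
    (λ x∈ y∈ eq → suc-injective (inj (there x∈) (there y∈) eq))
injection-≤ (inside ∷ S) T f into inj = ≤-trans (s≤s rest) (x∈p⇒∣p-x∣<∣p∣ (into here))
  where
  rest : ∣ S ∣ ≤ ∣ T - f zero here ∣
  rest = injection-≤ S (T - f zero here) (λ x x∈ → f (suc x) (there x∈))
    (λ x∈ → x∈p∧x≢y⇒x∈p-y (into (there x∈)) (λ eq → 0≢1+n (inj here (there x∈) (sym eq))))
    (λ x∈ y∈ eq → suc-injective (inj (there x∈) (there y∈) eq))

injection-< : ∀ {m n} (S : Subset m) (T : Subset n) (f : ∀ x → x ∈ S → Fin n) (a : Fin n) →
  a ∈ T → (∀ {x} (x∈ : x ∈ S) → f x x∈ ∈ T) → (∀ {x} (x∈ : x ∈ S) → f x x∈ ≢ a) →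
  (∀ {x y} (x∈ : x ∈ S) (y∈ : y ∈ S) → f x x∈ ≡ f y y∈ → x ≡ y) →
  ∣ S ∣ < ∣ T ∣
injection-< S T f a a∈T into miss inj =
  ≤-<-trans (injection-≤ S (T - a) f (λ x∈ → x∈p∧x≢y⇒x∈p-y (into x∈) (miss x∈)) inj)
            (x∈p⇒∣p-x∣<∣p∣ a∈T)

module _ {n : ℕ} (L : ℕ → Subset n) (increasing : ∀ j → L j ⊆ L (suc j)) where

  chain-stops-or-grows : ∀ j → (∃[ k ] L (suc k) ⊆ L k) ⊎ (j ≤ ∣ L j ∣)
  chain-stops-or-grows zero = inj₂ z≤n
  chain-stops-or-grows (suc j) with chain-stops-or-grows j
  ... | inj₁ stop = inj₁ stop
  ... | inj₂ j≤ with any? (λ x → (x ∈? L (suc j)) ×-dec ¬? (x ∈? L j))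
  ...   | yes (x , x∈ , x∉) = inj₂ (≤-trans (s≤s j≤) (p⊂q⇒∣p∣<∣q∣ (increasing j , x , x∈ , x∉)))
  ...   | no none = inj₁ (j , λ {x} x∈ → decidable-stable (x ∈? L j) (λ x∉ → none (x , x∈ , x∉)))

  chain-stabilises : ∃[ k ] L (suc k) ⊆ L k
  chain-stabilises with chain-stops-or-grows (suc n)
  ... | inj₁ stop = stop
  ... | inj₂ big  = ⊥-elim (<-irrefl refl (≤-trans big (∣p∣≤n (L (suc n)))))

module _ {A : Set} where

  unique-++ˡ : ∀ (xs : List A) {ys} → Unique (xs ++ ys) → Unique xs
  unique-++ˡ []       u           = []
  unique-++ˡ (x ∷ xs) (x∉ ∷ u) = ++⁻ˡ xs x∉ ∷ unique-++ˡ xs u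

  unique-++ʳ : ∀ (xs : List A) {ys} → Unique (xs ++ ys) → Unique ys
  unique-++ʳ []       u       = u
  unique-++ʳ (x ∷ xs) (_ ∷ u) = unique-++ʳ xs u

  unique-map-injective : ∀ {B : Set} (g : A → B) {xs x y} → Unique (map g xs) →
    x ∈ₗ xs → y ∈ₗ xs → g x ≡ g y → x ≡ y
  unique-map-injective g _              (here refl) (here refl) _  = refl
  unique-map-injective g (gx∉ ∷ _)      (here refl) (there y∈)  eq =
    ⊥-elim (All.lookup gx∉ (∈-map⁺ g y∈) eq)
  unique-map-injective g (gy∉ ∷ _)      (there x∈)  (here refl) eq =
    ⊥-elim (All.lookup gy∉ (∈-map⁺ g x∈) (sym eq))
  unique-map-injective g (_ ∷ u)        (there x∈)  (there y∈)  eq = unique-map-injective g u x∈ y∈ eq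

  unique-insert₂ : ∀ (xs ys : List A) {a b} → Unique (xs ++ ys) →
    a ∉ₗ xs ++ ys → b ∉ₗ xs ++ ys → a ≢ b → Unique (a ∷ xs ++ b ∷ ys)
  unique-insert₂ xs ys {a} u a∉ b∉ a≢b =
    PermProps.Unique-resp-↭ (setoid A)
      (Perm.↭-prep (setoid A) a (Perm.↭-sym (setoid A) (PermProps.↭-shift (setoid A) xs ys)))
      ((a≢b ∷ ¬Any⇒All¬ _ a∉) ∷ ¬Any⇒All¬ _ b∉ ∷ u)

module _ {n : ℕ} (i j : Fin n) where

  transpose-i : transpose i j i ≡ j
  transpose-i rewrite dec-true (i ≟ i) refl = refl

  transpose-j : transpose i j j ≡ i
  transpose-j with j ≟ i
  ... | yes j≡i = j≡i
  ... | no _ rewrite dec-true (j ≟ j) refl = refl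

  transpose-other : ∀ {k} → k ≢ i → k ≢ j → transpose i j k ≡ k
  transpose-other {k} k≢i k≢j rewrite dec-false (k ≟ i) k≢i | dec-false (k ≟ j) k≢j = refl

  transpose-injective : ∀ {k l} → transpose i j k ≡ transpose i j l → k ≡ l
  transpose-injective {k} {l} eq =
    trans (sym (transpose-inverse j i)) (trans (cong (transpose j i) eq) (transpose-inverse j i))

module Augmenting {n : ℕ} (G : Graph n) (P Q : Subset n) (P∩Q=∅ : ∀ {x} → x ∈ P → x ∈ Q → ⊥₀) where

  Edges : Set
  Edges = List (Fin n × Fin n)

  ends : Edges → List (Fin n)
  ends M = map proj₁ M ++ map proj₂ M

  module _ {M : Edges} (mat : IsMatching G P Q M) where

    edge-of : ∀ {e} → e ∈ₗ M → BipEdge G P Q (proj₁ e) (proj₂ e)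
    edge-of = proj₁ mat

    same-P-end : ∀ {e e′} → e ∈ₗ M → e′ ∈ₗ M → proj₁ e ≡ proj₁ e′ → e ≡ e′
    same-P-end = unique-map-injective proj₁ (unique-++ˡ (map proj₁ M) (proj₂ mat))

    same-Q-end : ∀ {e e′} → e ∈ₗ M → e′ ∈ₗ M → proj₂ e ≡ proj₂ e′ → e ≡ e′
    same-Q-end = unique-map-injective proj₂ (unique-++ʳ (map proj₁ M) (proj₂ mat))

    P-end∈P : ∀ {x} → x ∈ₗ map proj₁ M → x ∈ P
    P-end∈P x∈ with ∈-map⁻ proj₁ x∈
    ... | _ , e∈ , refl = proj₁ (edge-of e∈)

    Q-end∈Q : ∀ {x} → x ∈ₗ map proj₂ M → x ∈ Q
    Q-end∈Q x∈ with ∈-map⁻ proj₂ x∈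
    ... | _ , e∈ , refl = proj₁ (proj₂ (edge-of e∈))

  -- AltChain M a₀ Ps u: an M-alternating walk from a₀ to u, recorded by its matching
  -- edges (a , r) (latest first), each entered at its Q-end r from the previous
  -- vertex u′ and with a P-end a not used by an earlier matching edge.
  data AltChain (M : Edges) (a₀ : Fin n) : Edges → Fin n → Set where
    start  : AltChain M a₀ [] a₀
    extend : ∀ {Ps u a r} → AltChain M a₀ Ps u → adj G u r ≡ true → (a , r) ∈ₗ M →
             All (λ e → proj₁ e ≢ a) Ps → AltChain M a₀ ((a , r) ∷ Ps) a

  chain-transport : ∀ {M M′ a₀ a Ps u} → (∀ {e} → e ∈ₗ M → proj₁ e ≢ a → e ∈ₗ M′) →
    All (λ e → proj₁ e ≢ a) Ps → AltChain M a₀ Ps u → AltChain M′ a₀ Ps u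
  chain-transport keep _             start                    = start
  chain-transport keep (≢a ∷ avoid) (extend chain ur ar∈ fresh) =
    extend (chain-transport keep avoid chain) ur (keep ar∈ ≢a) fresh

  -- Re-matching a ∈ P from its partner r to an unmatched Q-neighbour q: replacing r by
  -- q (the transposition τ) in the Q-ends gives a matching of the same size in which r
  -- is unmatched, unmatched P-vertices stay unmatched and edges not at a are kept.
  module Rematch {M : Edges} (mat : IsMatching G P Q M) {a r q : Fin n} (ar∈M : (a , r) ∈ₗ M)
                 (q∈Q : q ∈ Q) (aq : adj G a q ≡ true) (q-free : Unmatched G P Q M q) where

    τ : Fin n → Fin n
    τ = transpose r q

    retarget : Fin n × Fin n → Fin n × Fin n
    retarget e = proj₁ e , τ (proj₂ e)

    M′ : Edges
    M′ = map retarget M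

    r∈Q : r ∈ Q
    r∈Q = proj₁ (proj₂ (edge-of mat ar∈M))

    P-fixed : ∀ {x} → x ∈ P → (τ x ≡ x) × (transpose q r x ≡ x)
    P-fixed x∈P = transpose-other r q ≢r ≢q , transpose-other q r ≢q ≢r
      where
      ≢r = λ eq → P∩Q=∅ x∈P (subst (_∈ Q) (sym eq) r∈Q)
      ≢q = λ eq → P∩Q=∅ x∈P (subst (_∈ Q) (sym eq) q∈Q)

    Q-end≢q : ∀ {e} → e ∈ₗ M → proj₂ e ≢ q
    Q-end≢q e∈ eq = q-free (∈-++⁺ʳ _ (subst (_∈ₗ map proj₂ M) eq (∈-map⁺ proj₂ e∈)))

    ends-M′ : ends M′ ≡ map τ (ends M)
    ends-M′ = begin
      map proj₁ M′ ++ map proj₂ M′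
        ≡⟨ cong₂ _++_ (sym (map-∘ M)) (trans (sym (map-∘ M)) (map-∘ M)) ⟩
      map proj₁ M ++ map τ (map proj₂ M)
        ≡⟨ cong (_++ map τ (map proj₂ M)) (sym (map-id-local fixed)) ⟩
      map τ (map proj₁ M) ++ map τ (map proj₂ M)
        ≡⟨ sym (map-++ τ (map proj₁ M) _) ⟩
      map τ (ends M)
        ∎
      where
      open ≡-Reasoning
      fixed : All (λ x → τ x ≡ x) (map proj₁ M)
      fixed = All.tabulate (λ x∈ → proj₁ (P-fixed (P-end∈P mat x∈)))

    ends-back : ∀ {v} → v ∈ₗ ends M′ → transpose q r v ∈ₗ ends M
    ends-back {v} v∈ with ∈-map⁻ τ (subst (v ∈ₗ_) ends-M′ v∈)
    ... | w , w∈ , refl = subst (_∈ₗ ends M) (sym (transpose-inverse q r)) w∈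

    retarget-edge : ∀ {e} → e ∈ₗ M → BipEdge G P Q (proj₁ e) (τ (proj₂ e))
    retarget-edge {e} e∈ = by-cases (proj₂ e ≟ r)
      where
      -- only the edge at r changes, and it becomes the edge a q
      by-cases : Dec (proj₂ e ≡ r) → BipEdge G P Q (proj₁ e) (τ (proj₂ e))
      by-cases (no e≢r) =
        subst (BipEdge G P Q (proj₁ e)) (sym (transpose-other r q e≢r (Q-end≢q e∈))) (edge-of mat e∈)
      by-cases (yes e≡r) with same-Q-end mat e∈ ar∈M e≡r
      ... | refl rewrite transpose-i r q = proj₁ (edge-of mat ar∈M) , q∈Q , aq

    rematch-matching : IsMatching G P Q M′
    rematch-matching = edges , subst Unique (sym ends-M′) (map⁺ (transpose-injective r q) (proj₂ mat))
      where
      edges : ∀ {e} → e ∈ₗ M′ → BipEdge G P Q (proj₁ e) (proj₂ e)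
      edges e∈ with ∈-map⁻ retarget e∈
      ... | _ , e∈M , refl = retarget-edge e∈M

    rematch-length : length M′ ≡ length M
    rematch-length = length-map retarget M

    rematch-frees-r : Unmatched G P Q M′ r
    rematch-frees-r r∈ = q-free (subst (_∈ₗ ends M) (transpose-j q r) (ends-back r∈))

    rematch-keeps-free : ∀ {v} → v ∈ P → Unmatched G P Q M v → Unmatched G P Q M′ v
    rematch-keeps-free v∈P v-free v∈ = v-free (subst (_∈ₗ ends M) (proj₂ (P-fixed v∈P)) (ends-back v∈))

    rematch-keeps : ∀ {e} → e ∈ₗ M → proj₁ e ≢ a → e ∈ₗ M′
    rematch-keeps {e} e∈ e≢a = subst (_∈ₗ M′) (cong (proj₁ e ,_) τe) (∈-map⁺ retarget e∈)
      where
      τe : τ (proj₂ e) ≡ proj₂ e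
      τe = transpose-other r q (λ eq → e≢a (cong proj₁ (same-Q-end mat e∈ ar∈M eq))) (Q-end≢q e∈)

  augment : ∀ {M a₀ Ps u q} → IsMatching G P Q M → a₀ ∈ P → Unmatched G P Q M a₀ →
    AltChain M a₀ Ps u → q ∈ Q → adj G u q ≡ true → Unmatched G P Q M q →
    ∃[ M″ ] IsMatching G P Q M″ × length M″ ≡ suc (length M)
  augment {M} {a₀} {q = q} mat a₀∈P a₀-free start q∈Q a₀q q-free =
    (a₀ , q) ∷ M , (edges , fresh) , refl
    where
    edges : ∀ {e} → e ∈ₗ (a₀ , q) ∷ M → BipEdge G P Q (proj₁ e) (proj₂ e)
    edges (here refl) = a₀∈P , q∈Q , a₀q
    edges (there e∈)  = edge-of mat e∈
    fresh : Unique (ends ((a₀ , q) ∷ M))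
    fresh = unique-insert₂ (map proj₁ M) (map proj₂ M) (proj₂ mat) a₀-free q-free
              (λ eq → P∩Q=∅ a₀∈P (subst (_∈ Q) (sym eq) q∈Q))
  augment {M} mat a₀∈P a₀-free (extend chain u′r ar∈M fresh) q∈Q aq q-free =
    same-gain (augment rematch-matching a₀∈P (rematch-keeps-free a₀∈P a₀-free)
                       (chain-transport rematch-keeps fresh chain) r∈Q u′r rematch-frees-r)
    where
    open Rematch mat ar∈M q∈Q aq q-free
    same-gain : ∃[ M″ ] IsMatching G P Q M″ × length M″ ≡ suc (length M′) →
                ∃[ M″ ] IsMatching G P Q M″ × length M″ ≡ suc (length M)
    same-gain (M″ , mat″ , len) = M″ , mat″ , trans len (cong suc rematch-length)

module AlternatingReach {n : ℕ} (G : Graph n) (P Q : Subset n) (P∩Q=∅ : ∀ {x} → x ∈ P → x ∈ Q → ⊥₀)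
                        (M : List (Fin n × Fin n)) (maxM : IsMaximumMatching G P Q M) where

  open Augmenting G P Q P∩Q=∅
  open DecMembership (_≟_ {n}) using () renaming (_∈?_ to _∈ₗ?_)

  mat : IsMatching G P Q M
  mat = proj₁ maxM

  Free : Fin n → Set
  Free v = v ∈ P × Unmatched G P Q M v

  free? : (v : Fin n) → Dec (Free v)
  free? v = (v ∈? P) ×-dec ¬? (v ∈ₗ? ends M)

  Enters : Subset n → Fin n → Set
  Enters S a = ∃[ r ] (a , r) ∈ₗ M × ∃[ u ] u ∈ S × adj G u r ≡ true

  enters? : (S : Subset n) (a : Fin n) → Dec (Enters S a)
  enters? S a = any? (λ r → DecMembership._∈?_ (≡-dec _≟_ _≟_) (a , r) M
                            ×-dec any? (λ u → (u ∈? S) ×-dec (adj G u r ≟ᵇ true)))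

  grow? : (S : Subset n) (a : Fin n) → Dec (a ∈ S ⊎ Enters S a)
  grow? S a = (a ∈? S) ⊎-dec enters? S a

  level : ℕ → Subset n
  level zero    = ⟦ free? ⟧
  level (suc j) = ⟦ grow? (level j) ⟧

  level-step : ∀ j {a} → a ∈ level (suc j) → a ∈ level j ⊎ Enters (level j) a
  level-step j = ∈⟦⟧⁻ (grow? (level j))

  level-⊆ : ∀ j → level j ⊆ level (suc j)
  level-⊆ j a∈ = ∈⟦⟧⁺ (grow? (level j)) (inj₁ a∈)

  stage : ℕ
  stage = proj₁ (chain-stabilises level level-⊆)

  R : Subset n
  R = level stage

  R-closed : ∀ {u r a} → u ∈ R → adj G u r ≡ true → (a , r) ∈ₗ M → a ∈ R
  R-closed u∈R ur ar∈M =
    proj₂ (chain-stabilises level level-⊆) (∈⟦⟧⁺ (grow? R) (inj₂ (_ , ar∈M , _ , u∈R , ur)))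

  free⊆level : ∀ j {a} → Free a → a ∈ level j
  free⊆level zero    a-free = ∈⟦⟧⁺ free? a-free
  free⊆level (suc j) a-free = level-⊆ j (free⊆level j a-free)

  level⊆R : ∀ j {a} → a ∈ level j → a ∈ R
  level⊆R zero    a∈ = free⊆level stage (∈⟦⟧⁻ free? a∈)
  level⊆R (suc j) a∈ with level-step j a∈
  ... | inj₁ a∈′                    = level⊆R j a∈′
  ... | inj₂ (_ , ar∈M , _ , u∈ , ur) = R-closed (level⊆R j u∈) ur ar∈M

  R⊆P : ∀ {a} → a ∈ R → a ∈ P
  R⊆P {a} = level⊆P stage
    where
    level⊆P : ∀ j {a} → a ∈ level j → a ∈ P
    level⊆P zero    a∈ = proj₁ (∈⟦⟧⁻ free? a∈)
    level⊆P (suc j) a∈ with level-step j a∈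
    ... | inj₁ a∈′            = level⊆P j a∈′
    ... | inj₂ (_ , ar∈M , _) = proj₁ (edge-of mat ar∈M)

  level-chain : ∀ j {a} → a ∈ level j →
    ∃[ a₀ ] Free a₀ × ∃[ Ps ] AltChain M a₀ Ps a × All (λ e → proj₁ e ∈ level j) Ps
  level-chain zero {a} a∈ = a , ∈⟦⟧⁻ free? a∈ , [] , start , []
  level-chain (suc j) {a} a∈ with a ∈? level j
  ... | yes a∈′ with level-chain j a∈′
  ...   | a₀ , a₀-free , Ps , chain , in-level =
          a₀ , a₀-free , Ps , chain , All.map (level-⊆ j) in-level
  level-chain (suc j) {a} a∈ | no a∉ with level-step j a∈
  ... | inj₁ a∈′ = ⊥-elim (a∉ a∈′)
  ... | inj₂ (r , ar∈M , u , u∈ , ur) with level-chain j u∈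
  ...   | a₀ , a₀-free , Ps , chain , in-level =
          a₀ , a₀-free , (a , r) ∷ Ps ,
          extend chain ur ar∈M (All.map (λ e∈ eq → a∉ (subst (_∈ level j) eq e∈)) in-level) ,
          a∈ ∷ All.map (level-⊆ j) in-level

  -- (1) every Q-neighbour of R is matched: otherwise M could be augmented
  neighbour-matched : ∀ {u v} → u ∈ R → v ∈ Q → adj G u v ≡ true → v ∈ₗ ends M
  neighbour-matched {u} {v} u∈R v∈Q uv with v ∈ₗ? ends M
  ... | yes v∈ = v∈
  ... | no v-free with level-chain stage u∈R
  ...   | a₀ , (a₀∈P , a₀-free) , Ps , chain , _ with augment mat a₀∈P a₀-free chain v∈Q uv v-free
  ...     | M″ , mat″ , longer = ⊥-elim (<-irrefl refl (subst (_≤ length M) longer (proj₂ maxM M″ mat″)))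

  neighbour-partner : ∀ {u v} → u ∈ R → v ∈ Q → adj G u v ≡ true → ∃[ x ] (x , v) ∈ₗ M
  neighbour-partner u∈R v∈Q uv with ∈-++⁻ (map proj₁ M) (neighbour-matched u∈R v∈Q uv)
  ... | inj₁ v∈ = ⊥-elim (P∩Q=∅ (P-end∈P mat v∈) v∈Q)
  ... | inj₂ v∈ with ∈-map⁻ proj₂ v∈
  ...   | e , e∈ , refl = proj₁ e , e∈

  -- where an alternating walk is: at a P-vertex of R about to take a non-matching
  -- edge (false), or at a Q-neighbour of R about to take a matching edge (true)
  OnTrack : Bool → Fin n → Set
  OnTrack false v = v ∈ P × v ∈ R
  OnTrack true  v = v ∈ Q × ∃[ u ] u ∈ R × adj G u v ≡ true

  walk-in-R : ∀ {b v vs} → Alt G P Q M b (v ∷ vs) → OnTrack b v → All (λ x → x ∈ P → x ∈ R) (v ∷ vs)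
  walk-in-R {false} (single _)  (_ , v∈R)   = (λ _ → v∈R) ∷ []
  walk-in-R {true}  (single _)  (v∈Q , _)   = (λ v∈P → ⊥-elim (P∩Q=∅ v∈P v∈Q)) ∷ []
  walk-in-R {false} (step _ _ _ (inj₁ (_ , v∈Q , uv)) _ rest) (u∈P , u∈R) =
    (λ _ → u∈R) ∷ walk-in-R rest (v∈Q , _ , u∈R , uv)
  walk-in-R {false} (step _ _ _ (inj₂ (_ , u∈Q , _)) _ _)   (u∈P , _) = ⊥-elim (P∩Q=∅ u∈P u∈Q)
  walk-in-R {true}  (step _ _ _ _ (inj₁ uv∈M) _)             (u∈Q , _) =
    ⊥-elim (P∩Q=∅ (proj₁ (edge-of mat uv∈M)) u∈Q)
  walk-in-R {true}  (step _ _ _ _ (inj₂ vu∈M) rest)          (u∈Q , u′ , u′∈R , u′u) =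
    (λ u∈P → ⊥-elim (P∩Q=∅ u∈P u∈Q)) ∷
    walk-in-R rest (proj₁ (edge-of mat vu∈M) , R-closed u′∈R u′u vu∈M)

  free-path-in-R : ∀ {p q} → OnFreeAltPath G P Q M p q → p ∈ P → p ∈ R
  free-path-in-R {p} {q} (v ∷ vs , (v∈P , v-free , _ , alt) , l , r , split) =
    All.lookup (walk-in-R alt (v∈P , free⊆level stage (v∈P , v-free))) (on-path split)
    where
    on-path : ∀ {ws} → ws ≡ l ++ p ∷ q ∷ r ⊎ ws ≡ l ++ q ∷ p ∷ r → p ∈ₗ ws
    on-path (inj₁ refl) = ∈-++⁺ʳ l (here refl)
    on-path (inj₂ refl) = ∈-++⁺ʳ l (there (here refl))

module KonigVsCover {n : ℕ} (G : Graph n) (A B X : Subset n) (part : IsPartition3 A B X)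
                    (M : List (Fin n × Fin n)) (maxM : IsMaximumMatching G A (B ∪ X) M)
                    (C : Subset n) (minC : IsMinVertexCover G (A ∪ X) B C) where

  A∩B=∅ : ∀ {x} → x ∈ A → x ∈ B → ⊥₀
  A∩B=∅ x∈A x∈B = ∉⊥ (subst (_ ∈_) (proj₁ part) (x∈p∩q⁺ (x∈A , x∈B)))

  A∩Q=∅ : ∀ {x} → x ∈ A → x ∈ B ∪ X → ⊥₀
  A∩Q=∅ x∈A x∈Q with x∈p∪q⁻ B X x∈Q
  ... | inj₁ x∈B = A∩B=∅ x∈A x∈B
  ... | inj₂ x∈X = ∉⊥ (subst (_ ∈_) (proj₁ (proj₂ part)) (x∈p∩q⁺ (x∈A , x∈X)))

  open Augmenting G A (B ∪ X) A∩Q=∅ using (ends; edge-of; same-P-end; Q-end∈Q)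
  open AlternatingReach G A (B ∪ X) A∩Q=∅ M maxM
  open DecMembership (_≟_ {n}) using () renaming (_∈?_ to _∈ₗ?_)

  covers : ∀ {p q} → p ∈ A ∪ X → q ∈ B → adj G p q ≡ true → p ∈ C ⊎ q ∈ C
  covers p∈ q∈B pq = proj₂ (proj₁ minC) _ _ (p∈ , q∈B , pq)

  -- A matching edge xv with v ∈ B is an edge of G[A∪X,B], so x ∈ C when v ∉ C.
  partner-in-C : ∀ {x v} → (x , v) ∈ₗ M → v ∈ B → v ∉ C → x ∈ C
  partner-in-C xv∈M v∈B v∉C with covers (x∈p∪q⁺ (inj₁ (proj₁ (edge-of mat xv∈M)))) v∈B
                                          (proj₂ (proj₂ (edge-of mat xv∈M)))
  ... | inj₁ x∈C = x∈C
  ... | inj₂ v∈C = ⊥-elim (v∉C v∈C)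

  -- Replacing R ∩ C by the B-neighbours of R outside C gives
  -- a vertex cover C′ of G[A∪X,B] smaller than C, which is impossible.
  module Exchange {a : Fin n} (a∈R : a ∈ R) (a∈C : a ∈ C)
                  (a-partner : ∀ {w} → w ∈ B → w ∉ C → (a , w) ∈ₗ M → ⊥₀) where

    InC′ : Fin n → Set
    InC′ v = (v ∈ C × v ∉ R) ⊎ (v ∈ B × v ∉ C × ∃[ u ] u ∈ R × adj G u v ≡ true)

    InC′? : (v : Fin n) → Dec (InC′ v)
    InC′? v = ((v ∈? C) ×-dec ¬? (v ∈? R)) ⊎-dec
              ((v ∈? B) ×-dec ¬? (v ∈? C) ×-dec any? (λ u → (u ∈? R) ×-dec (adj G u v ≟ᵇ true)))

    C′ : Subset n
    C′ = ⟦ InC′? ⟧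

    B∉R : ∀ {v} → v ∈ B → v ∉ R
    B∉R v∈B v∈R = A∩B=∅ (R⊆P v∈R) v∈B

    C′-cover : IsVertexCover G (A ∪ X) B C′
    C′-cover = C′⊆ , edges
      where
      C′⊆ : C′ ⊆ (A ∪ X) ∪ B
      C′⊆ v∈ with ∈⟦⟧⁻ InC′? v∈
      ... | inj₁ (v∈C , _) = proj₁ (proj₁ minC) v∈C
      ... | inj₂ (v∈B , _) = x∈p∪q⁺ (inj₂ v∈B)
      -- an edge pq with p ∈ R ∩ C and q ∉ C is covered by the new vertex q
      edges : ∀ p q → BipEdge G (A ∪ X) B p q → p ∈ C′ ⊎ q ∈ C′
      edges p q (p∈ , q∈B , pq) with covers p∈ q∈B pq | p ∈? R | q ∈? C
      ... | inj₂ q∈C | _       | _       = inj₂ (∈⟦⟧⁺ InC′? (inj₁ (q∈C , B∉R q∈B)))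
      ... | inj₁ p∈C | no p∉R  | _       = inj₁ (∈⟦⟧⁺ InC′? (inj₁ (p∈C , p∉R)))
      ... | inj₁ _   | yes _   | yes q∈C = inj₂ (∈⟦⟧⁺ InC′? (inj₁ (q∈C , B∉R q∈B)))
      ... | inj₁ _   | yes p∈R | no q∉C  = inj₂ (∈⟦⟧⁺ InC′? (inj₂ (q∈B , q∉C , p , p∈R , pq)))

    -- a vertex of C′ is an old vertex of C ∖ R, or a new one whose matching
    -- partner lies in (R ∩ C) ∖ {a}
    Source : Fin n → Set
    Source v = (v ∈ C × v ∉ R) ⊎ (∃[ x ] (x , v) ∈ₗ M × x ∈ R × x ∈ C × x ≢ a)

    source : ∀ {v} → v ∈ C′ → Source v
    source v∈ with ∈⟦⟧⁻ InC′? v∈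
    ... | inj₁ old = inj₁ old
    ... | inj₂ (v∈B , v∉C , u , u∈R , uv) with neighbour-partner u∈R (x∈p∪q⁺ (inj₁ v∈B)) uv
    ...   | x , xv∈M = inj₂ (x , xv∈M , R-closed u∈R uv xv∈M , partner-in-C xv∈M v∈B v∉C ,
                             λ { refl → a-partner v∈B v∉C xv∈M })

    image : ∀ {v} → Source v → Fin n
    image {v} = [ const v , proj₁ ]

    image-injective : ∀ {v w} (s : Source v) (t : Source w) → image s ≡ image t → v ≡ w
    image-injective (inj₁ _)                (inj₁ _)                eq = eq
    image-injective (inj₁ (_ , v∉R))        (inj₂ (_ , _ , x∈R , _)) eq =
      ⊥-elim (v∉R (subst (_∈ R) (sym eq) x∈R))
    image-injective (inj₂ (_ , _ , x∈R , _)) (inj₁ (_ , w∉R))        eq =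
      ⊥-elim (w∉R (subst (_∈ R) eq x∈R))
    image-injective (inj₂ (_ , xv∈M , _))   (inj₂ (_ , yw∈M , _))   eq =
      cong proj₂ (same-P-end mat xv∈M yw∈M eq)

    C′-smaller : ∣ C′ ∣ < ∣ C ∣
    C′-smaller = injection-< C′ C (λ _ v∈ → image (source v∈)) a a∈C into misses-a
                   (λ v∈ w∈ → image-injective (source v∈) (source w∈))
      where
      into : ∀ {v} (v∈ : v ∈ C′) → image (source v∈) ∈ C
      into v∈ with source v∈
      ... | inj₁ (v∈C , _)         = v∈C
      ... | inj₂ (_ , _ , _ , x∈C , _) = x∈C
      misses-a : ∀ {v} (v∈ : v ∈ C′) → image (source v∈) ≢ a
      misses-a v∈ with source v∈
      ... | inj₁ (_ , v∉R)          = λ { refl → v∉R a∈R }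
      ... | inj₂ (_ , _ , _ , _ , x≢a) = x≢a

    impossible : ⊥₀
    impossible = <-irrefl refl (≤-<-trans (proj₂ minC C′ C′-cover) C′-smaller)

  -- No vertex of a level is in C, by induction on the level: a vertex entering at
  -- level j+1 through its matching edge ar from u ∈ level j has r ∈ C whenever r ∈ B
  -- (as u ∉ C covers nothing), so the exchange argument applies to it.
  level∩C=∅ : ∀ j {a} → a ∈ level j → a ∉ C
  level∩C=∅ zero a∈ a∈C = Exchange.impossible (level⊆R 0 a∈) a∈C
    (λ _ _ aw∈M → proj₂ (∈⟦⟧⁻ free? a∈) (∈-++⁺ˡ (∈-map⁺ proj₁ aw∈M)))
  level∩C=∅ (suc j) a∈ a∈C with level-step j a∈
  ... | inj₁ a∈′ = level∩C=∅ j a∈′ a∈C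
  ... | inj₂ (r , ar∈M , u , u∈ , ur) = Exchange.impossible (level⊆R (suc j) a∈) a∈C r-in-C
    where
    r-in-C : ∀ {w} → w ∈ B → w ∉ C → (_ , w) ∈ₗ M → ⊥₀
    r-in-C w∈B w∉C aw∈M with same-P-end mat aw∈M ar∈M refl
    ... | refl with covers (x∈p∪q⁺ (inj₁ (R⊆P (level⊆R j u∈)))) w∈B ur
    ...   | inj₁ u∈C = level∩C=∅ j u∈ u∈C
    ...   | inj₂ w∈C = w∉C w∈C

  R∩C=∅ : ∀ {a} → a ∈ R → a ∉ C
  R∩C=∅ = level∩C=∅ stage

  -- An A-vertex of C is matched (free vertices lie in R), and its matching edge is on
  -- no alternating path from a free vertex (its A-end would lie in R).
  A∩C⊆C_A : ∀ v → v ∈ A → v ∈ C → InKonigCover G A (B ∪ X) M v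
  A∩C⊆C_A v v∈A v∈C with v ∈ₗ? ends M
  ... | no v-free = ⊥-elim (R∩C=∅ (free⊆level stage (v∈A , v-free)) v∈C)
  ... | yes v∈ends with ∈-++⁻ (map proj₁ M) v∈ends
  ...   | inj₂ v∈Q-ends = ⊥-elim (A∩Q=∅ v∈A (Q-end∈Q mat v∈Q-ends))
  ...   | inj₁ v∈A-ends with ∈-map⁻ proj₁ v∈A-ends
  ...     | (v , q) , vq∈M , refl =
    v , q , vq∈M , inj₂ ((λ on → R∩C=∅ (free-path-in-R on v∈A) v∈C) , refl)

  -- A B-vertex of C_A is the Q-end of a matching edge pq on such a path; then p ∈ R,
  -- so p ∉ C and C covers pq at q.
  B∩C_A⊆C : ∀ v → v ∈ B → InKonigCover G A (B ∪ X) M v → v ∈ C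
  B∩C_A⊆C v v∈B (p , q , pq∈M , inj₂ (_ , refl)) = ⊥-elim (A∩B=∅ (proj₁ (edge-of mat pq∈M)) v∈B)
  B∩C_A⊆C v v∈B (p , q , pq∈M , inj₁ (on , refl)) with
    covers (x∈p∪q⁺ (inj₁ (proj₁ (edge-of mat pq∈M)))) v∈B (proj₂ (proj₂ (edge-of mat pq∈M)))
  ... | inj₁ p∈C = ⊥-elim (R∩C=∅ (free-path-in-R on (proj₁ (edge-of mat pq∈M))) p∈C)
  ... | inj₂ q∈C = q∈C

lemma3 : ∀ {n} (G : Graph n) (A B X : Subset n) → IsPartition3 A B X →
    (M : List (Fin n × Fin n)) → IsMaximumMatching G A (B ∪ X) M →
    (C : Subset n) → IsMinVertexCover G (A ∪ X) B C →
    (∀ v → v ∈ A → v ∈ C → InKonigCover G A (B ∪ X) M v)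
    × (∀ v → v ∈ B → InKonigCover G A (B ∪ X) M v → v ∈ C)
lemma3 G A B X part M maxM C minC =
  KonigVsCover.A∩C⊆C_A G A B X part M maxM C minC ,
  KonigVsCover.B∩C_A⊆C G A B X part M maxM C minC
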